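{- Let $M$ be a maximal path-like map such that $\mathbf{P}_{VEF}(M)$ has a realizer $\{L_1,L_2,L_3\}$, fix an angle coloring induced by this realizer and the resulting oriented coloring of the chordal edges. Then no two bicolored faces have the same (set of) colors.
   Context: A planar map consists of a finite planar multigraph with a plane drawing; $\mathbf{P}_{VEF}(M)$ is the poset on vertices, edges and faces ordered by incidence/inclusion. A realizer of a poset is a family of linear extensions whose intersection is the poset; a pair $(a,b)$ is reversed in $L$ if $b<a$ in $L$. A simple 2-connected outerplanar map has a unique Hamilton cycle; its edges are cycle edges, the rest chordal edges. $M$ is path-like if its interior dual is a simple path (then the Hamilton cycle bounds the outer face), and maximal path-like if in addition every bounded face is a triangle. An inner angle is a pair $(u,T)$, $T$ an interior triangle with vertices $u,v,w$; its critical pair is $(u,vw)$ if $vw$ is a cycle edge and $(u,F)$, $F$ the other interior face containing $vw$, if $vw$ is chordal. An angle coloring induced by the realizer assigns to each inner angle a color $i\in\{1,2,3\}$ such that its critical pair is reversed in $L_i$. For a chordal edge $\{a,b\}$ lying in triangles $T_\ell,T_r$, among the four angles of $T_\ell,T_r$ at $a$ and at $b$ exactly one color occurs twice, namely as the two angles at a single endpoint; the oriented coloring gives the chordal edge this color and orients it towards that endpoint. The colors of an interior face are the colors of the chordal edges on its boundary; a face is bicolored if it has exactly two colors. -}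

module Defs where

open import Data.Nat using (ℕ; zero; suc; _≤_; _∸_) renaming (_<_ to _<ℕ_)
open import Data.Fin using (Fin; toℕ) renaming (zero to f0; suc to fs)
open import Data.Product using (Σ; ∃; ∃-syntax; _×_; _,_)
open import Data.Sum using (_⊎_)
open import Data.Unit using (⊤)
open import Data.Empty using (⊥)
open import Relation.Nullary using (¬_)
open import Relation.Binary.PropositionalEquality using (_≡_; _≢_)

-- The vertices are Fin n, numbered 0,1,…,n-1 along the (unique) Hamilton
-- cycle, which bounds the outer face; we think of them as points in convex
-- position in this cyclic order.

record Triangle (n : ℕ) : Set where
  field
    a b c : Fin n
    a<b   : toℕ a <ℕ toℕ b
    b<c   : toℕ b <ℕ toℕ c

corner : ∀ {n} → Triangle n → Fin 3 → Fin n
corner T f0           = Triangle.a T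
corner T (fs f0)      = Triangle.b T
corner T (fs (fs f0)) = Triangle.c T

oppositeLo oppositeHi : ∀ {n} → Triangle n → Fin 3 → Fin n
oppositeLo T f0           = Triangle.b T
oppositeLo T (fs f0)      = Triangle.a T
oppositeLo T (fs (fs f0)) = Triangle.a T
oppositeHi T f0           = Triangle.c T
oppositeHi T (fs f0)      = Triangle.c T
oppositeHi T (fs (fs f0)) = Triangle.b T

EdgeOfT : ∀ {n} → Triangle n → Fin n → Fin n → Set
EdgeOfT T i j = toℕ i <ℕ toℕ j × (∃[ k ] corner T k ≡ i) × (∃[ k ] corner T k ≡ j)

CycleEdge : ∀ {n} → Fin n → Fin n → Set
CycleEdge {n} i j = toℕ j ≡ suc (toℕ i) ⊎ (toℕ i ≡ 0 × suc (toℕ j) ≡ n)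

Cross : ∀ {n} → Fin n → Fin n → Fin n → Fin n → Set
Cross i j i' j' = toℕ i <ℕ toℕ i' × toℕ i' <ℕ toℕ j × toℕ j <ℕ toℕ j'

SharesEdge : ∀ {n m} → (Fin m → Triangle n) → Fin m → Fin m → Set
SharesEdge tri s t = s ≢ t × ∃[ i ] ∃[ j ] (EdgeOfT (tri s) i j × EdgeOfT (tri t) i j)

-- A maximal path-like map on n vertices: a triangulation of the convex
-- n-gon into n-2 pairwise distinct, pairwise non-crossing triangles (so
-- these are exactly the bounded faces, all triangles), indexed along the
-- interior dual, which is a simple path: two bounded faces share an edge
-- iff their indices are consecutive.
record MaxPathLike (n : ℕ) : Set where
  field
    3≤n      : 3 ≤ n
    tri      : Fin (n ∸ 2) → Triangle n
    distinct : ∀ s t → (∀ k → corner (tri s) k ≡ corner (tri t) k) → s ≡ t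
    noCross  : ∀ s t i j i' j' → EdgeOfT (tri s) i j → EdgeOfT (tri t) i' j'
               → ¬ Cross i j i' j'
    dualPath : ∀ s t → (SharesEdge tri s t → (suc (toℕ s) ≡ toℕ t ⊎ suc (toℕ t) ≡ toℕ s))
                     × ((suc (toℕ s) ≡ toℕ t ⊎ suc (toℕ t) ≡ toℕ s) → SharesEdge tri s t)

-- elements: vertices, edges {i,j} (i<j), interior faces, the outer face
data Elem (n m : ℕ) : Set where
  V : Fin n → Elem n m
  E : Fin n → Fin n → Elem n m
  F : Fin m → Elem n m
  O : Elem n m

module _ {n : ℕ} (M : MaxPathLike n) where
  open MaxPathLike M

  EdgeOf : Fin (n ∸ 2) → Fin n → Fin n → Set
  EdgeOf t = EdgeOfT (tri t)

  Valid : Elem n (n ∸ 2) → Set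
  Valid (V x)   = ⊤
  Valid (E i j) = ∃[ t ] EdgeOf t i j
  Valid (F t)   = ⊤
  Valid O       = ⊤

  _<P_ : Elem n (n ∸ 2) → Elem n (n ∸ 2) → Set
  V x   <P E i j = x ≡ i ⊎ x ≡ j
  V x   <P F t   = ∃[ k ] corner (tri t) k ≡ x
  V x   <P O     = ⊤
  E i j <P F t   = EdgeOf t i j
  E i j <P O     = CycleEdge i j
  _     <P _     = ⊥

  record LinExt : Set where
    field
      rank : Elem n (n ∸ 2) → ℕ
      inj  : ∀ x y → Valid x → Valid y → rank x ≡ rank y → x ≡ y
      mono : ∀ x y → Valid x → Valid y → x <P y → rank x <ℕ rank y

  Reversed : LinExt → Elem n (n ∸ 2) → Elem n (n ∸ 2) → Set
  Reversed L x y = LinExt.rank L y <ℕ LinExt.rank L x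

  record Realizer : Set where
    field
      L     : Fin 3 → LinExt
      exact : ∀ x y → Valid x → Valid y
              → (∀ i → LinExt.rank (L i) x <ℕ LinExt.rank (L i) y) → x <P y

  -- Inner angles are pairs (t , k): the corner k of the interior triangle t.
  -- The critical pair of (t,k) is reversed in L:
  --  * opposite edge vw a cycle edge: (u , vw) reversed;
  --  * vw chordal: (u , F) reversed, F the other interior face containing vw.
  CriticalReversed : LinExt → Fin (n ∸ 2) → Fin 3 → Set
  CriticalReversed L t k =
    (CycleEdge v w → Reversed L (V u) (E v w)) ×
    (¬ CycleEdge v w → ∀ t' → t' ≢ t → EdgeOf t' v w → Reversed L (V u) (F t'))
    where
      u = corner (tri t) k
      v = oppositeLo (tri t) k
      w = oppositeHi (tri t) k

  record AngleColoring (R : Realizer) : Set where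
    field
      col  : Fin (n ∸ 2) → Fin 3 → Fin 3
      good : ∀ t k → CriticalReversed (Realizer.L R (col t k)) t k

  module _ {R : Realizer} (C : AngleColoring R) where
    open AngleColoring C

    ChordColor : Fin (n ∸ 2) → Fin (n ∸ 2) → Fin n → Fin n → Fin 3 → Set
    ChordColor t t' i j c =
      ∃[ x ] ((x ≡ i ⊎ x ≡ j) ×
        ∃[ k ] ∃[ k' ] (corner (tri t) k ≡ x × corner (tri t') k' ≡ x
                        × col t k ≡ c × col t' k' ≡ c))

    HasColor : Fin (n ∸ 2) → Fin 3 → Set
    HasColor t c = ∃[ i ] ∃[ j ] (EdgeOf t i j × ¬ CycleEdge i j ×
                     ∃[ t' ] (t' ≢ t × EdgeOf t' i j × ChordColor t t' i j c))

    Bicolored : Fin (n ∸ 2) → Set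
    Bicolored t = ∃[ c₁ ] ∃[ c₂ ] (c₁ ≢ c₂ × HasColor t c₁ × HasColor t c₂ ×
                    (∀ c → HasColor t c → c ≡ c₁ ⊎ c ≡ c₂))

module Submission where

-- In L_q, the corner carrying the angle of colour q is the top corner of its triangle. Consequently,
-- if (E i j , O) is reversed in L_q for a chordal edge {i,j} of colour c, then q = c, and every
-- colour c of a face F satisfies O < F in L_c. Two distinct faces s and t each have a corner v, w
-- not on the other; the incomparable pairs (V v , F s) and (V w , F t) can then only be reversed in
-- the colour missing from s and t, giving the cycle F s < V v < F t < V w < F s in that extension.
-- The geometric input is that every chordal side of a face is shared with another face.

open import Defs
open import Data.Nat using (ℕ; zero; suc; _+_; _∸_; _≟_; z≤n; s≤s; s≤s⁻¹; _≤?_; _<?_) renaming (_<_ to _<ℕ_; _≤_ to _≤ℕ_)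
open import Data.Nat.Properties using (<-irrefl; <-trans; <-asym; 1+n≰n; ≤-<-trans; <-≤-trans; n≮0; <⇒≱; <⇒≤; ≤-reflexive; ≤-trans; ≤-antisym; <-cmp; ≤∧≢⇒<; +-identityʳ; +-suc; +-monoˡ-≤; m≤n+m; n<1+n; m<n⇒m<1+n; ≤-refl; ≮⇒≥)
open import Data.Fin using (Fin; toℕ; punchOut; fromℕ<; inject₁) renaming (zero to f0; suc to fs)
open import Data.Fin.Properties using (<⇒≢; ¬∀⟶∃¬; all?; toℕ-injective; toℕ<n; toℕ-fromℕ<; toℕ-inject₁; ℕ<⇒inject₁<; any?; pigeonhole; injective⇒≤; punchOut-injective)
  renaming (_≟_ to _≟f_; <-cmp to <-cmpᶠ)
open import Data.Product using (∃-syntax; _×_; _,_; proj₁; proj₂)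
open import Data.Sum using (_⊎_; inj₁; inj₂)
open import Data.Empty using (⊥; ⊥-elim)
open import Data.Unit using (tt)
open import Function using (_∘_)
open import Function.Definitions using (Injective)
open import Relation.Nullary using (¬_; Dec; yes; no; contradiction)
open import Relation.Nullary.Decidable using (¬?; _×-dec_; _⊎-dec_)
open import Relation.Binary using (tri<; tri≈; tri>)
open import Relation.Binary.PropositionalEquality using (_≡_; _≢_; refl; sym; trans; cong; subst; subst₂)

injective⇒surjective : ∀ {n} {f : Fin n → Fin n} → Injective _≡_ _≡_ f → ∀ y → ∃[ x ] f x ≡ y
injective⇒surjective {suc n} {f} f-inj y with any? (λ x → f x ≟f y)
... | yes hit = hit
... | no miss = contradiction (injective⇒≤ punched-injective) 1+n≰n
  where
  y≢f : ∀ x → y ≢ f x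
  y≢f x y≡fx = miss (x , sym y≡fx)
  punched : Fin (suc n) → Fin n
  punched x = punchOut (y≢f x)
  punched-injective : Injective _≡_ _≡_ punched
  punched-injective {x} {x′} = f-inj ∘ punchOut-injective (y≢f x) (y≢f x′)

third-unique : ∀ {a b x y : Fin 3} → a ≢ b → x ≢ a → x ≢ b → y ≢ a → y ≢ b → x ≡ y
third-unique {a} {b} {x} {y} a≢b x≢a x≢b y≢a y≢b
  with pigeonhole (s≤s (s≤s (s≤s (s≤s z≤n)))) listed
  where
  listed : Fin 4 → Fin 3
  listed f0                = a
  listed (fs f0)           = b
  listed (fs (fs f0))      = x
  listed (fs (fs (fs f0))) = y
... | f0 , fs f0 , _ , e = ⊥-elim (a≢b e)
... | f0 , fs (fs f0) , _ , e = ⊥-elim (x≢a (sym e))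
... | f0 , fs (fs (fs f0)) , _ , e = ⊥-elim (y≢a (sym e))
... | fs f0 , fs (fs f0) , _ , e = ⊥-elim (x≢b (sym e))
... | fs f0 , fs (fs (fs f0)) , _ , e = ⊥-elim (y≢b (sym e))
... | fs (fs f0) , fs (fs (fs f0)) , _ , e = e
... | f0 , f0 , () , _
... | fs _ , f0 , () , _
... | fs f0 , fs f0 , s≤s () , _
... | fs (fs _) , fs f0 , s≤s () , _
... | fs (fs f0) , fs (fs f0) , s≤s (s≤s ()) , _
... | fs (fs (fs _)) , fs (fs f0) , s≤s (s≤s ()) , _
... | fs (fs (fs f0)) , fs (fs (fs f0)) , s≤s (s≤s (s≤s ())) , _

increasing-triple : ∀ {x y z : Fin 3} → toℕ x <ℕ toℕ y → toℕ y <ℕ toℕ z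
                  → x ≡ f0 × y ≡ fs f0 × z ≡ fs (fs f0)
increasing-triple {f0} {fs f0} {fs (fs f0)} _ _ = refl , refl , refl
increasing-triple {_} {f0} ()
increasing-triple {_} {fs _} {f0} _ ()
increasing-triple {_} {fs f0} {fs f0} _ (s≤s ())
increasing-triple {_} {fs (fs f0)} {fs f0} _ (s≤s ())
increasing-triple {_} {fs (fs f0)} {fs (fs f0)} _ (s≤s (s≤s ()))
increasing-triple {fs _} {fs f0} (s≤s ())
increasing-triple {fs (fs _)} {fs (fs f0)} (s≤s (s≤s ()))

IsCorner : ∀ {n} → Triangle n → Fin n → Set
IsCorner T x = ∃[ k ] corner T k ≡ x

isCorner? : ∀ {n} (T : Triangle n) x → Dec (IsCorner T x)
isCorner? T x = any? λ k → corner T k ≟f x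

edgeOfT? : ∀ {n} (T : Triangle n) x y → Dec (EdgeOfT T x y)
edgeOfT? T x y = (toℕ x <? toℕ y) ×-dec isCorner? T x ×-dec isCorner? T y

record Spans {n} (T : Triangle n) (x y z : Fin n) : Set where
  field
    edge     : EdgeOfT T x y
    z-corner : IsCorner T z
    z≢x      : z ≢ x
    z≢y      : z ≢ y
    covers   : ∀ k → corner T k ≡ x ⊎ corner T k ≡ y ⊎ corner T k ≡ z

  x<y : toℕ x <ℕ toℕ y
  x<y = proj₁ edge

  x-corner : IsCorner T x
  x-corner = proj₁ (proj₂ edge)

  y-corner : IsCorner T y
  y-corner = proj₂ (proj₂ edge)

module TriangleProperties {n} (T : Triangle n) where
  open Triangle T

  corner-strictMono : ∀ {k k′} → toℕ k <ℕ toℕ k′ → toℕ (corner T k) <ℕ toℕ (corner T k′)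
  corner-strictMono {f0}    {fs f0}      _ = a<b
  corner-strictMono {f0}    {fs (fs f0)} _ = <-trans a<b b<c
  corner-strictMono {fs f0} {fs (fs f0)} _ = b<c
  corner-strictMono {_}     {f0}         ()
  corner-strictMono {fs f0} {fs f0}      (s≤s ())
  corner-strictMono {fs (fs f0)} {fs f0} (s≤s ())
  corner-strictMono {fs (fs f0)} {fs (fs f0)} (s≤s (s≤s ()))

  corner-injective : Injective _≡_ _≡_ (corner T)
  corner-injective {k} {k′} eq with <-cmpᶠ k k′
  ... | tri< k<k′ _ _ = contradiction eq (<⇒≢ (corner-strictMono k<k′))
  ... | tri≈ _ k≡k′ _ = k≡k′
  ... | tri> _ _ k′<k = contradiction (sym eq) (<⇒≢ (corner-strictMono k′<k))

  corner-reflects-< : ∀ {k k′} → toℕ (corner T k) <ℕ toℕ (corner T k′) → toℕ k <ℕ toℕ k′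
  corner-reflects-< {k} {k′} c<c′ with <-cmpᶠ k k′
  ... | tri< k<k′ _ _ = k<k′
  ... | tri≈ _ refl _ = contradiction c<c′ (<-irrefl refl)
  ... | tri> _ _ k′<k = contradiction c<c′ (<-asym (corner-strictMono k′<k))

  opposite-spans : ∀ k → Spans T (oppositeLo T k) (oppositeHi T k) (corner T k)
  opposite-spans f0 = record
    { edge = b<c , (fs f0 , refl) , (fs (fs f0) , refl) ; z-corner = f0 , refl
    ; z≢x = <⇒≢ a<b ; z≢y = <⇒≢ (<-trans a<b b<c)
    ; covers = λ { f0 → inj₂ (inj₂ refl) ; (fs f0) → inj₁ refl ; (fs (fs f0)) → inj₂ (inj₁ refl) } }
  opposite-spans (fs f0) = record
    { edge = <-trans a<b b<c , (f0 , refl) , (fs (fs f0) , refl) ; z-corner = fs f0 , refl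
    ; z≢x = <⇒≢ a<b ∘ sym ; z≢y = <⇒≢ b<c
    ; covers = λ { f0 → inj₁ refl ; (fs f0) → inj₂ (inj₂ refl) ; (fs (fs f0)) → inj₂ (inj₁ refl) } }
  opposite-spans (fs (fs f0)) = record
    { edge = a<b , (f0 , refl) , (fs f0 , refl) ; z-corner = fs (fs f0) , refl
    ; z≢x = <⇒≢ (<-trans a<b b<c) ∘ sym ; z≢y = <⇒≢ b<c ∘ sym
    ; covers = λ { f0 → inj₁ refl ; (fs f0) → inj₂ (inj₁ refl) ; (fs (fs f0)) → inj₂ (inj₂ refl) } }

  opposite-edge : ∀ k → EdgeOfT T (oppositeLo T k) (oppositeHi T k)
  opposite-edge k = Spans.edge (opposite-spans k)

  other-corner-opposite : ∀ {k x} → IsCorner T x → x ≢ corner T k → x ≡ oppositeLo T k ⊎ x ≡ oppositeHi T k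
  other-corner-opposite {k} (k′ , refl) x≢u with Spans.covers (opposite-spans k) k′
  ... | inj₁ x≡v         = inj₁ x≡v
  ... | inj₂ (inj₁ x≡w)  = inj₂ x≡w
  ... | inj₂ (inj₂ x≡u)  = contradiction x≡u x≢u

  edge-opposite : ∀ {i j} → EdgeOfT T i j → ∃[ k ] oppositeLo T k ≡ i × oppositeHi T k ≡ j
  edge-opposite (i<j , (ki , refl) , (kj , refl)) = go ki kj (corner-reflects-< i<j)
    where
    go : ∀ ki kj → toℕ ki <ℕ toℕ kj → ∃[ k ] oppositeLo T k ≡ corner T ki × oppositeHi T k ≡ corner T kj
    go f0           (fs f0)      _ = fs (fs f0) , refl , refl
    go f0           (fs (fs f0)) _ = fs f0 , refl , refl
    go (fs f0)      (fs (fs f0)) _ = f0 , refl , refl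
    go _            f0           ()
    go (fs f0)      (fs f0)      (s≤s ())
    go (fs (fs f0)) (fs f0)      (s≤s ())
    go (fs (fs f0)) (fs (fs f0)) (s≤s (s≤s ()))

same-corners : ∀ {n} (T T′ : Triangle n) → (∀ k → IsCorner T′ (corner T k)) → ∀ k → corner T k ≡ corner T′ k
same-corners T T′ in-T′ k = trans (sym (proj₂ (in-T′ k))) (cong (corner T′) (σ-identity k))
  where
  σ : Fin 3 → Fin 3
  σ k = proj₁ (in-T′ k)
  σ-increasing : ∀ {k k′} → toℕ k <ℕ toℕ k′ → toℕ (σ k) <ℕ toℕ (σ k′)
  σ-increasing {k} {k′} k<k′ = TriangleProperties.corner-reflects-< T′
    (subst₂ (λ x y → toℕ x <ℕ toℕ y) (sym (proj₂ (in-T′ k))) (sym (proj₂ (in-T′ k′)))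
      (TriangleProperties.corner-strictMono T k<k′))
  σ-identity : ∀ k → σ k ≡ k
  σ-identity k with increasing-triple (σ-increasing {f0} {fs f0} (s≤s z≤n))
                                      (σ-increasing {fs f0} {fs (fs f0)} (s≤s (s≤s z≤n)))
  σ-identity f0           | σ0 , _ , _ = σ0
  σ-identity (fs f0)      | _ , σ1 , _ = σ1
  σ-identity (fs (fs f0)) | _ , _ , σ2 = σ2

edge-apex : ∀ {n} {T : Triangle n} {x y} → EdgeOfT T x y → ∃[ z ] Spans T x y z
edge-apex {T = T} xy with TriangleProperties.edge-opposite T xy
... | k , refl , refl = corner T k , TriangleProperties.opposite-spans T k

spans-corners : ∀ {n} {T T′ : Triangle n} {x y z} → Spans T x y z → Spans T′ x y z
              → ∀ k → IsCorner T′ (corner T k)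
spans-corners S S′ k with Spans.covers S k
... | inj₁ refl        = Spans.x-corner S′
... | inj₂ (inj₁ refl) = Spans.y-corner S′
... | inj₂ (inj₂ refl) = Spans.z-corner S′

endpoint-corner : ∀ {n} {T : Triangle n} {i j x} → EdgeOfT T i j → x ≡ i ⊎ x ≡ j → IsCorner T x
endpoint-corner (_ , i-corner , _) (inj₁ refl) = i-corner
endpoint-corner (_ , _ , j-corner) (inj₂ refl) = j-corner

apex-not-endpoint : ∀ {n} {T : Triangle n} {i j z y} → Spans T i j z → y ≡ i ⊎ y ≡ j → z ≢ y
apex-not-endpoint S (inj₁ refl) = Spans.z≢x S
apex-not-endpoint S (inj₂ refl) = Spans.z≢y S

cycleEdge? : ∀ {n} (x y : Fin n) → Dec (CycleEdge x y)
cycleEdge? {n} x y = (toℕ y ≟ suc (toℕ x)) ⊎-dec ((toℕ x ≟ 0) ×-dec (suc (toℕ y) ≟ n))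

Between Beyond : ∀ {n} → Fin n → Fin n → Fin n → Set
Between x y z = toℕ x <ℕ toℕ z × toℕ z <ℕ toℕ y
Beyond  x y z = toℕ z <ℕ toℕ x ⊎ toℕ y <ℕ toℕ z

nothing-between-neighbours : ∀ {n} {x y z : Fin n} → toℕ y ≡ suc (toℕ x) → ¬ Between x y z
nothing-between-neighbours y≡1+x (x<z , z<y) rewrite y≡1+x = <-irrefl refl (≤-<-trans (s≤s⁻¹ z<y) x<z)

nothing-beyond-outer-edge : ∀ {n} {x y z : Fin n} → toℕ x ≡ 0 → suc (toℕ y) ≡ n → ¬ Beyond x y z
nothing-beyond-outer-edge x≡0 _ (inj₁ z<x) rewrite x≡0 = n≮0 z<x
nothing-beyond-outer-edge {z = z} _ 1+y≡n (inj₂ y<z) =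
  <⇒≱ y<z (s≤s⁻¹ (subst (suc (toℕ z) ≤ℕ_) (sym 1+y≡n) (toℕ<n z)))

SameSide : ∀ {n} → Fin n → Fin n → Fin n → Fin n → Set
SameSide x y z z′ = (Between x y z × Between x y z′) ⊎ (Beyond x y z × Beyond x y z′)

apex-side : ∀ {n} {T : Triangle n} {x y z} → Spans T x y z → Between x y z ⊎ Beyond x y z
apex-side {x = x} {y} {z} S with <-cmpᶠ z x
... | tri< z<x _ _ = inj₂ (inj₁ z<x)
... | tri≈ _ z≡x _ = contradiction z≡x (Spans.z≢x S)
... | tri> _ _ x<z with <-cmpᶠ z y
...   | tri< z<y _ _ = inj₁ (x<z , z<y)
...   | tri≈ _ z≡y _ = contradiction z≡y (Spans.z≢y S)
...   | tri> _ _ y<z = inj₂ (inj₂ y<z)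

module FaceGeometry {n} (M : MaxPathLike n) where
  open MaxPathLike M

  face-determined : ∀ {s t} → (∀ k → IsCorner (tri t) (corner (tri s) k)) → s ≡ t
  face-determined {s} {t} in-t = distinct s t (same-corners (tri s) (tri t) in-t)

  private-corner : ∀ {s t} → s ≢ t → ∃[ k ] ¬ IsCorner (tri t) (corner (tri s) k)
  private-corner {s} {t} s≢t with all? (λ k → isCorner? (tri t) (corner (tri s) k))
  ... | yes all-shared = contradiction (face-determined all-shared) s≢t
  ... | no not-all = ¬∀⟶∃¬ 3 _ (λ k → isCorner? (tri t) (corner (tri s) k)) not-all

  apexes-distinct : ∀ {s t x y z z′} → s ≢ t → Spans (tri s) x y z → Spans (tri t) x y z′ → z ≢ z′
  apexes-distinct s≢t S T refl = s≢t (face-determined (spans-corners S T))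

  ordered-apexes-opposite : ∀ {s t x y z z′} → Spans (tri s) x y z → Spans (tri t) x y z′
                          → toℕ z <ℕ toℕ z′ → ¬ SameSide x y z z′
  ordered-apexes-opposite {s} {t} {x} {y} {z} {z′} S T z<z′ = crossing
    where
    module S = Spans S
    module T = Spans T
    crossing : ¬ SameSide x y z z′
    crossing (inj₁ ((x<z , z<y) , (x<z′ , z′<y))) =
      noCross t s x z′ z y (x<z′ , T.x-corner , T.z-corner) (z<y , S.z-corner , S.y-corner) (x<z , z<z′ , z′<y)
    crossing (inj₂ (_ , inj₁ z′<x)) =
      noCross s t z x z′ y (<-trans z<z′ z′<x , S.z-corner , S.x-corner) (<-trans z′<x S.x<y , T.z-corner , T.y-corner)
        (z<z′ , z′<x , S.x<y)
    crossing (inj₂ (inj₁ z<x , inj₂ y<z′)) =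
      noCross s t z y x z′ (<-trans z<x S.x<y , S.z-corner , S.y-corner) (<-trans S.x<y y<z′ , T.x-corner , T.z-corner)
        (z<x , S.x<y , y<z′)
    crossing (inj₂ (inj₂ y<z , inj₂ y<z′)) =
      noCross s t x z y z′ (<-trans S.x<y y<z , S.x-corner , S.z-corner) (y<z′ , T.y-corner , T.z-corner)
        (S.x<y , y<z , z<z′)

  apexes-opposite : ∀ {s t x y z z′} → s ≢ t → Spans (tri s) x y z → Spans (tri t) x y z′
                  → ¬ SameSide x y z z′
  apexes-opposite {z = z} {z′} s≢t S T same with <-cmpᶠ z z′
  ... | tri< z<z′ _ _ = ordered-apexes-opposite S T z<z′ same
  ... | tri≈ _ z≡z′ _ = apexes-distinct s≢t S T z≡z′
  ... | tri> _ _ z′<z = ordered-apexes-opposite T S z′<z (swap same)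
    where
    swap : SameSide _ _ z z′ → SameSide _ _ z′ z
    swap (inj₁ (p , q)) = inj₁ (q , p)
    swap (inj₂ (p , q)) = inj₂ (q , p)

  edge-in-at-most-two-faces : ∀ {s₁ s₂ s₃ x y} → s₁ ≢ s₂ → s₁ ≢ s₃ → s₂ ≢ s₃
                            → EdgeOf M s₁ x y → EdgeOf M s₂ x y → EdgeOf M s₃ x y → ⊥
  edge-in-at-most-two-faces s₁≢s₂ s₁≢s₃ s₂≢s₃ e₁ e₂ e₃
    with edge-apex e₁ | edge-apex e₂ | edge-apex e₃
  ... | _ , S₁ | _ , S₂ | _ , S₃ with apex-side S₁ | apex-side S₂ | apex-side S₃
  ... | inj₁ b₁ | inj₁ b₂ | _       = apexes-opposite s₁≢s₂ S₁ S₂ (inj₁ (b₁ , b₂))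
  ... | inj₂ b₁ | inj₂ b₂ | _       = apexes-opposite s₁≢s₂ S₁ S₂ (inj₂ (b₁ , b₂))
  ... | inj₁ b₁ | inj₂ _  | inj₁ b₃ = apexes-opposite s₁≢s₃ S₁ S₃ (inj₁ (b₁ , b₃))
  ... | inj₁ _  | inj₂ b₂ | inj₂ b₃ = apexes-opposite s₂≢s₃ S₂ S₃ (inj₂ (b₂ , b₃))
  ... | inj₂ _  | inj₁ b₂ | inj₁ b₃ = apexes-opposite s₂≢s₃ S₂ S₃ (inj₁ (b₂ , b₃))
  ... | inj₂ b₁ | inj₁ _  | inj₂ b₃ = apexes-opposite s₁≢s₃ S₁ S₃ (inj₂ (b₁ , b₃))

  shared-edge-chordal : ∀ {s t x y} → s ≢ t → EdgeOf M s x y → EdgeOf M t x y → ¬ CycleEdge x y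
  shared-edge-chordal s≢t e e′ cycle with edge-apex e | edge-apex e′
  ... | _ , S | _ , S′ with apex-side S | apex-side S′ | cycle
  ... | inj₁ b | _       | inj₁ y≡1+x = nothing-between-neighbours y≡1+x b
  ... | _      | inj₁ b′ | inj₁ y≡1+x = nothing-between-neighbours y≡1+x b′
  ... | inj₂ b | inj₂ b′ | inj₁ _     = apexes-opposite s≢t S S′ (inj₂ (b , b′))
  ... | inj₂ b | _       | inj₂ (x≡0 , 1+y≡n) = nothing-beyond-outer-edge x≡0 1+y≡n b
  ... | _      | inj₂ b′ | inj₂ (x≡0 , 1+y≡n) = nothing-beyond-outer-edge x≡0 1+y≡n b′
  ... | inj₁ b | inj₁ b′ | inj₂ _     = apexes-opposite s≢t S S′ (inj₁ (b , b′))

-- A laminar family of distinct integer intervals [lo a, hi a] ⊆ [0, m+1] of length ≥ 2 has at most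
-- m members: each interval has an interior point covered by none of its proper sub-intervals, and
-- distinct intervals get distinct such points.
module Laminar {k m : ℕ} (lo hi : Fin k → ℕ)
  (wide         : ∀ a → suc (lo a) <ℕ hi a)
  (bounded      : ∀ a → hi a ≤ℕ suc m)
  (non-crossing : ∀ a b → ¬ (lo a <ℕ lo b × lo b <ℕ hi a × hi a <ℕ hi b))
  (distinct     : ∀ a b → lo a ≡ lo b → hi a ≡ hi b → a ≡ b)
  where

  _⊑_ : Fin k → Fin k → Set
  b ⊑ a = lo a ≤ℕ lo b × hi b ≤ℕ hi a

  Covers : Fin k → ℕ → Set
  Covers a p = lo a <ℕ p × p <ℕ hi a

  Exposed : Fin k → ℕ → Set
  Exposed a p = Covers a p × (∀ b → b ≢ a → b ⊑ a → ¬ Covers b p)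

  nested : ∀ {a b p} → Covers a p → Covers b p → a ⊑ b ⊎ b ⊑ a
  nested {a} {b} (lo-a<p , p<hi-a) (lo-b<p , p<hi-b) with <-cmp (lo a) (lo b) | <-cmp (hi a) (hi b)
  ... | tri< la<lb _ _ | tri< ha<hb _ _ = contradiction (la<lb , <-trans lo-b<p p<hi-a , ha<hb) (non-crossing a b)
  ... | tri< la<lb _ _ | tri≈ _ ha≡hb _ = inj₂ (<⇒≤ la<lb , ≤-reflexive (sym ha≡hb))
  ... | tri< la<lb _ _ | tri> _ _ hb<ha = inj₂ (<⇒≤ la<lb , <⇒≤ hb<ha)
  ... | tri≈ _ la≡lb _ | tri< ha<hb _ _ = inj₁ (≤-reflexive (sym la≡lb) , <⇒≤ ha<hb)
  ... | tri≈ _ la≡lb _ | tri≈ _ ha≡hb _ = inj₁ (≤-reflexive (sym la≡lb) , ≤-reflexive ha≡hb)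
  ... | tri≈ _ la≡lb _ | tri> _ _ hb<ha = inj₂ (≤-reflexive la≡lb , <⇒≤ hb<ha)
  ... | tri> _ _ lb<la | tri< ha<hb _ _ = inj₁ (<⇒≤ lb<la , <⇒≤ ha<hb)
  ... | tri> _ _ lb<la | tri≈ _ ha≡hb _ = inj₁ (<⇒≤ lb<la , ≤-reflexive ha≡hb)
  ... | tri> _ _ lb<la | tri> _ _ hb<ha = contradiction (lb<la , <-trans lo-a<p p<hi-b , hb<ha) (non-crossing b a)

  exposed-injective : ∀ {a b p} → Exposed a p → Exposed b p → a ≡ b
  exposed-injective {a} {b} (ca , a-exposed) (cb , b-exposed) with a ≟f b
  ... | yes a≡b = a≡b
  ... | no a≢b with nested ca cb
  ...   | inj₁ a⊑b = contradiction ca (b-exposed a a≢b a⊑b)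
  ...   | inj₂ b⊑a = contradiction cb (a-exposed b (a≢b ∘ sym) b⊑a)

  ProperSubCover : Fin k → ℕ → Set
  ProperSubCover a q = ∃[ b ] b ≢ a × b ⊑ a × Covers b q

  proper-sub-cover? : ∀ a q → Dec (ProperSubCover a q)
  proper-sub-cover? a q = any? λ b →
    ¬? (b ≟f a) ×-dec (lo a ≤? lo b ×-dec hi b ≤? hi a) ×-dec (lo b <? q ×-dec q <? hi b)

  LeftAligned : Fin k → ℕ → Set
  LeftAligned a q = ∀ b → b ≢ a → b ⊑ a → Covers b q → lo b ≡ lo a

  -- Scan the interior of a from left to right, jumping over the maximal sub-intervals
  -- that start at lo a; fuel bounds the number of jumps.
  search : ∀ a fuel q → hi a ≤ℕ q + fuel → Covers a q → LeftAligned a q → ∃[ p ] Exposed a p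
  search a zero q hi≤q (_ , q<hi) _ = contradiction (subst (hi a ≤ℕ_) (+-identityʳ q) hi≤q) (<⇒≱ q<hi)
  search a (suc fuel) q hi≤q+fuel (lo<q , q<hi) aligned with proper-sub-cover? a q
  ... | no none = q , (lo<q , q<hi) , λ b b≢a b⊑a cb → none (b , b≢a , b⊑a , cb)
  ... | yes (b , b≢a , (la≤lb , hb≤ha) , (lb<q , q<hb)) =
    search a fuel (hi b) hi≤hb+fuel (<-trans lo<q q<hb , hb<ha) aligned′
    where
    lb≡la : lo b ≡ lo a
    lb≡la = aligned b b≢a (la≤lb , hb≤ha) (lb<q , q<hb)
    hb<ha : hi b <ℕ hi a
    hb<ha = ≤∧≢⇒< hb≤ha (b≢a ∘ distinct b a lb≡la)
    hi≤hb+fuel : hi a ≤ℕ hi b + fuel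
    hi≤hb+fuel = ≤-trans hi≤q+fuel (subst (_≤ℕ hi b + fuel) (sym (+-suc q fuel)) (+-monoˡ-≤ fuel q<hb))
    aligned′ : LeftAligned a (hi b)
    aligned′ b′ _ (la≤lb′ , _) (lb′<hb , hb<hb′) with <-cmp (lo a) (lo b′)
    ... | tri< la<lb′ _ _ = contradiction (subst (_<ℕ lo b′) (sym lb≡la) la<lb′ , lb′<hb , hb<hb′) (non-crossing b b′)
    ... | tri≈ _ la≡lb′ _ = sym la≡lb′
    ... | tri> _ _ lb′<la = contradiction la≤lb′ (<⇒≱ lb′<la)

  exposed-exists : ∀ a → ∃[ p ] Exposed a p
  exposed-exists a = search a (hi a) (suc (lo a)) (m≤n+m (hi a) (suc (lo a))) (n<1+n (lo a) , wide a) starts-left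
    where
    starts-left : LeftAligned a (suc (lo a))
    starts-left b _ (la≤lb , _) (lb<1+la , _) = ≤-antisym (s≤s⁻¹ lb<1+la) la≤lb

  exposed-index : ∀ a → ∃[ i ] Exposed a (suc (toℕ i))
  exposed-index a with exposed-exists a
  ... | zero  , (() , _) , _
  ... | suc r , exposed@((_ , 1+r<hi) , _) =
    fromℕ< (s≤s⁻¹ (<-≤-trans 1+r<hi (bounded a))) ,
    subst (λ p → Exposed a (suc p)) (sym (toℕ-fromℕ< _)) exposed

  size-bound : k ≤ℕ m
  size-bound = injective⇒≤ {f = λ a → proj₁ (exposed-index a)} λ {a} {b} i≡j →
    exposed-injective (proj₂ (exposed-index a))
      (subst (λ i → Exposed b (suc (toℕ i))) (sym i≡j) (proj₂ (exposed-index b)))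

-- An unshared chordal side {v,w} would give n - 1 distinct non-crossing chords of the n-gon:
-- {v,w}, the n - 3 sides shared by consecutive faces of the dual path, and the outer edge {0,n-1}.
module UnsharedChord {q : ℕ} (M : MaxPathLike (suc (suc (suc q)))) {s : Fin (suc q)} {v w}
  (vw-edge : EdgeOf M s v w) (vw-chordal : ¬ CycleEdge v w) (unshared : ∀ t → t ≢ s → ¬ EdgeOf M t v w)
  where
  open MaxPathLike M
  open FaceGeometry M

  shared : (k : Fin q) → SharesEdge tri (inject₁ k) (fs k)
  shared k = proj₂ (dualPath (inject₁ k) (fs k)) (inj₁ (cong suc (toℕ-inject₁ k)))

  chord-lo chord-hi : Fin (suc q) → Fin (suc (suc (suc q)))
  chord-lo f0     = v
  chord-lo (fs k) = proj₁ (proj₂ (shared k))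
  chord-hi f0     = w
  chord-hi (fs k) = proj₁ (proj₂ (proj₂ (shared k)))

  shared-left : ∀ k → EdgeOf M (inject₁ k) (chord-lo (fs k)) (chord-hi (fs k))
  shared-left k = proj₁ (proj₂ (proj₂ (proj₂ (shared k))))

  shared-right : ∀ k → EdgeOf M (fs k) (chord-lo (fs k)) (chord-hi (fs k))
  shared-right k = proj₂ (proj₂ (proj₂ (proj₂ (shared k))))

  chord-edge : ∀ r → ∃[ t ] EdgeOf M t (chord-lo r) (chord-hi r)
  chord-edge f0     = s , vw-edge
  chord-edge (fs k) = inject₁ k , shared-left k

  chord-chordal : ∀ r → ¬ CycleEdge (chord-lo r) (chord-hi r)
  chord-chordal f0     = vw-chordal
  chord-chordal (fs k) = shared-edge-chordal (proj₁ (shared k)) (shared-left k) (shared-right k)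

  shared-chord-not-vw : ∀ k → chord-lo (fs k) ≡ v → chord-hi (fs k) ≡ w → ⊥
  shared-chord-not-vw k refl refl with inject₁ k ≟f s
  ... | no  k≢s = unshared (inject₁ k) k≢s (shared-left k)
  ... | yes refl = unshared (fs k) (proj₁ (shared k) ∘ sym) (shared-right k)

  shared-chords-differ : ∀ {k k′} → toℕ k <ℕ toℕ k′
                   → chord-lo (fs k) ≡ chord-lo (fs k′) → chord-hi (fs k) ≡ chord-hi (fs k′) → ⊥
  shared-chords-differ {k} {k′} k<k′ lo≡ hi≡ =
    edge-in-at-most-two-faces (proj₁ (shared k)) (<⇒≢ (ℕ<⇒inject₁< (m<n⇒m<1+n k<k′))) (<⇒≢ (s≤s k<k′))
      (shared-left k) (shared-right k) (subst₂ (EdgeOf M (fs k′)) (sym lo≡) (sym hi≡) (shared-right k′))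

  chord-injective : ∀ r r′ → chord-lo r ≡ chord-lo r′ → chord-hi r ≡ chord-hi r′ → r ≡ r′
  chord-injective f0      f0      _   _   = refl
  chord-injective f0      (fs k)  lo≡ hi≡ = ⊥-elim (shared-chord-not-vw k (sym lo≡) (sym hi≡))
  chord-injective (fs k)  f0      lo≡ hi≡ = ⊥-elim (shared-chord-not-vw k lo≡ hi≡)
  chord-injective (fs k)  (fs k′) lo≡ hi≡ with <-cmpᶠ k k′
  ... | tri< k<k′ _ _ = ⊥-elim (shared-chords-differ k<k′ lo≡ hi≡)
  ... | tri≈ _ k≡k′ _ = cong fs k≡k′
  ... | tri> _ _ k′<k = ⊥-elim (shared-chords-differ k′<k (sym lo≡) (sym hi≡))

  lo hi : Fin (suc (suc q)) → ℕ
  lo f0     = 0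
  lo (fs r) = toℕ (chord-lo r)
  hi f0     = suc (suc q)
  hi (fs r) = toℕ (chord-hi r)

  wide : ∀ a → suc (lo a) <ℕ hi a
  wide f0     = s≤s (s≤s z≤n)
  wide (fs r) with chord-edge r
  ... | _ , (lo<hi , _) = ≤∧≢⇒< lo<hi (chord-chordal r ∘ inj₁ ∘ sym)

  bounded : ∀ a → hi a ≤ℕ suc (suc q)
  bounded f0     = ≤-refl
  bounded (fs r) = s≤s⁻¹ (toℕ<n (chord-hi r))

  non-crossing : ∀ a b → ¬ (lo a <ℕ lo b × lo b <ℕ hi a × hi a <ℕ hi b)
  non-crossing _       f0      (() , _)
  non-crossing f0      (fs r)  (_ , _ , outer<hi) = <⇒≱ outer<hi (bounded (fs r))
  non-crossing (fs r)  (fs r′) crossing with chord-edge r | chord-edge r′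
  ... | t , e | t′ , e′ = noCross t t′ _ _ _ _ e e′ crossing

  distinct-chords : ∀ a b → lo a ≡ lo b → hi a ≡ hi b → a ≡ b
  distinct-chords f0      f0      _   _   = refl
  distinct-chords f0      (fs r)  lo≡ hi≡ = ⊥-elim (chord-chordal r (inj₂ (sym lo≡ , cong suc (sym hi≡))))
  distinct-chords (fs r)  f0      lo≡ hi≡ = ⊥-elim (chord-chordal r (inj₂ (lo≡ , cong suc hi≡)))
  distinct-chords (fs r)  (fs r′) lo≡ hi≡ = cong fs (chord-injective r r′ (toℕ-injective lo≡) (toℕ-injective hi≡))

  absurd : ⊥
  absurd = 1+n≰n (Laminar.size-bound lo hi wide bounded non-crossing distinct-chords)

unshared-chord-absurd : ∀ {n} (M : MaxPathLike n) {s v w} → EdgeOf M s v w → ¬ CycleEdge v w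
                      → (∀ t → t ≢ s → ¬ EdgeOf M t v w) → ⊥
unshared-chord-absurd {zero}                M {()}
unshared-chord-absurd {suc zero}            M {()}
unshared-chord-absurd {suc (suc zero)}      M {()}
unshared-chord-absurd {suc (suc (suc q))}   M = UnsharedChord.absurd M

chordal-edge-shared : ∀ {n} (M : MaxPathLike n) {s v w} → EdgeOf M s v w → ¬ CycleEdge v w
                    → ∃[ t ] t ≢ s × EdgeOf M t v w
chordal-edge-shared M {s} {v} {w} vw-edge vw-chordal
  with any? (λ t → ¬? (t ≟f s) ×-dec edgeOfT? (MaxPathLike.tri M t) v w)
... | yes found = found
... | no none = ⊥-elim (unshared-chord-absurd M vw-edge vw-chordal λ t t≢s e → none (t , t≢s , e))

module Colouring {n} (M : MaxPathLike n) (R : Realizer M) (C : AngleColoring M R) where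
  open MaxPathLike M
  open AngleColoring C
  open FaceGeometry M

  rank : Fin 3 → Elem n (n ∸ 2) → ℕ
  rank q = LinExt.rank (Realizer.L R q)

  _<[_]_ : Elem n (n ∸ 2) → Fin 3 → Elem n (n ∸ 2) → Set
  x <[ q ] y = rank q x <ℕ rank q y

  no-4-cycle : ∀ {q a b c d} → a <[ q ] b → b <[ q ] c → c <[ q ] d → d <[ q ] a → ⊥
  no-4-cycle a<b b<c c<d d<a = <-irrefl refl (<-trans a<b (<-trans b<c (<-trans c<d d<a)))

  vertex<outer : ∀ q x → V x <[ q ] O
  vertex<outer q x = LinExt.mono (Realizer.L R q) (V x) O tt tt tt

  vertex<face : ∀ q {x t} → IsCorner (tri t) x → V x <[ q ] F t
  vertex<face q {x} {t} x∈t = LinExt.mono (Realizer.L R q) (V x) (F t) tt tt x∈t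

  vertex<edge : ∀ q {x t i j} → EdgeOf M t i j → x ≡ i ⊎ x ≡ j → V x <[ q ] E i j
  vertex<edge q {x} {t} {i} {j} e x∈ij = LinExt.mono (Realizer.L R q) (V x) (E i j) tt (t , e) x∈ij

  edge<face : ∀ q {t i j} → EdgeOf M t i j → E i j <[ q ] F t
  edge<face q {t} {i} {j} e = LinExt.mono (Realizer.L R q) (E i j) (F t) (t , e) tt e

  realizer-reverses : ∀ x y → Valid M x → Valid M y → ¬ _<P_ M x y → x ≢ y → ∃[ q ] y <[ q ] x
  realizer-reverses x y x-valid y-valid x≮y x≢y with all? (λ q → rank q x <? rank q y)
  ... | yes x<y-everywhere = contradiction (Realizer.exact R x y x-valid y-valid x<y-everywhere) x≮y
  ... | no not-everywhere with ¬∀⟶∃¬ 3 _ (λ q → rank q x <? rank q y) not-everywhere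
  ...   | q , x≮[q]y = q , ≤∧≢⇒< (≮⇒≥ x≮[q]y) (x≢y ∘ sym ∘ LinExt.inj (Realizer.L R q) y x y-valid x-valid)

  Angle : Fin (n ∸ 2) → Fin n → Fin 3 → Set
  Angle t u q = ∃[ k ] corner (tri t) k ≡ u × col t k ≡ q

  corner-angle : ∀ {t u} → IsCorner (tri t) u → ∃[ q ] Angle t u q
  corner-angle {t} (k , refl) = col t k , k , refl , refl

  -- The critical pair of the angle at u puts u above the opposite side in L_q, or above the
  -- other face on that side, and hence above both other corners.
  angle-top : ∀ {t u q x} → Angle t u q → IsCorner (tri t) x → x ≢ u → V x <[ q ] V u
  angle-top {t} (k , refl , refl) x∈t x≢u
    with TriangleProperties.other-corner-opposite (tri t) {k} x∈t x≢u
       | cycleEdge? (oppositeLo (tri t) k) (oppositeHi (tri t) k)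
  ... | x∈vw | yes cycle = <-trans (vertex<edge (col t k) vw-edge x∈vw) (proj₁ (good t k) cycle)
    where vw-edge = TriangleProperties.opposite-edge (tri t) k
  ... | x∈vw | no chordal with chordal-edge-shared M (TriangleProperties.opposite-edge (tri t) k) chordal
  ...   | t′ , t′≢t , e′ = <-trans (vertex<face (col t k) (endpoint-corner e′ x∈vw)) (proj₂ (good t k) chordal t′ t′≢t e′)

  col-injective : ∀ t → Injective _≡_ _≡_ (col t)
  col-injective t {k} {k′} same-colour with k ≟f k′
  ... | yes k≡k′ = k≡k′
  ... | no k≢k′ = contradiction
    (angle-top (k , refl , refl) (k′ , refl) u′≢u)
    (<-asym (angle-top (k′ , refl , sym same-colour) (k , refl) (u′≢u ∘ sym)))
    where
    u′≢u : corner (tri t) k′ ≢ corner (tri t) k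
    u′≢u = k≢k′ ∘ sym ∘ TriangleProperties.corner-injective (tri t)

  angle-exists : ∀ t q → ∃[ u ] Angle t u q
  angle-exists t q with injective⇒surjective (col-injective t) q
  ... | k , col≡q = corner (tri t) k , k , refl , col≡q

  angle-colours-distinct : ∀ {t u u′ q q′} → Angle t u q → Angle t u′ q′ → u ≢ u′ → q ≢ q′
  angle-colours-distinct (k , refl , refl) (k′ , refl , refl) u≢u′ same = u≢u′ (cong (corner _) (col-injective _ same))

  angle-colour-unique : ∀ {t u q q′} → Angle t u q → Angle t u q′ → q ≡ q′
  angle-colour-unique {t} (k , refl , refl) (k′ , u≡ , refl) =
    cong (col t) (TriangleProperties.corner-injective (tri t) (sym u≡))

  -- The apex z of t over the chordal side {i,j} has critical pair (z, t′).
  apex-angle : ∀ {t t′ i j z r} → t′ ≢ t → ¬ CycleEdge i j → Spans (tri t) i j z → EdgeOf M t′ i j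
             → Angle t z r → F t′ <[ r ] V z
  apex-angle {t} {t′} t′≢t chordal S e′ (k , refl , refl) with TriangleProperties.edge-opposite (tri t) (Spans.edge S)
  ... | k₀ , refl , refl with Spans.covers (TriangleProperties.opposite-spans (tri t) k₀) k
  ...   | inj₁ z≡i        = contradiction z≡i (Spans.z≢x S)
  ...   | inj₂ (inj₁ z≡j) = contradiction z≡j (Spans.z≢y S)
  ...   | inj₂ (inj₂ z≡z₀) with TriangleProperties.corner-injective (tri t) {k} {k₀} z≡z₀
  ...     | refl = proj₂ (good t k) chordal t′ t′≢t e′

  reversed-chord-angle : ∀ {t t′ i j z u q} → t′ ≢ t → ¬ CycleEdge i j → Spans (tri t) i j z → EdgeOf M t′ i j
                       → O <[ q ] E i j → Angle t u q → u ≡ i ⊎ u ≡ j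
  reversed-chord-angle {t} {t′} {q = q} t′≢t chordal S e′ O<ij (k , refl , refl) with Spans.covers S k
  ... | inj₁ u≡i        = inj₁ u≡i
  ... | inj₂ (inj₁ u≡j) = inj₂ u≡j
  ... | inj₂ (inj₂ refl) =
    ⊥-elim (no-4-cycle (apex-angle t′≢t chordal S e′ (k , refl , refl)) (vertex<outer q _) O<ij (edge<face q e′))

  -- If (E i j , O) is reversed in L_q, the q-angles of t and t′ lie at endpoints of {i,j}. Unless
  -- the q-angle of t is at the endpoint carrying the chord colour c, the apexes of t and t′ both
  -- get the third colour r, and their critical pairs close a cycle in L_r.
  reversed-chord-colour : ∀ {t t′ i j c q} → t′ ≢ t → ¬ CycleEdge i j → EdgeOf M t i j → EdgeOf M t′ i j
                        → ChordColor M C t t′ i j c → O <[ q ] E i j → q ≡ c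
  reversed-chord-colour {t} {t′} {i} {j} {c} {q} t′≢t chordal e e′ (x , x∈ij , k , k′ , ex , ex′ , ck , ck′) O<ij
    with angle-exists t q | angle-exists t′ q
  ... | u , u-q | u′ , u′-q with u ≟f x
  ...   | yes refl = angle-colour-unique u-q (k , ex , ck)
  ...   | no u≢x with edge-apex e | edge-apex e′
  ...     | z , S | z′ , S′ with corner-angle (Spans.z-corner S) | corner-angle (Spans.z-corner S′)
  ...       | r , z-r | r′ , z′-r′ = ⊥-elim (no-4-cycle
              (apex-angle t′≢t chordal S e′ z-r) (vertex<face r (Spans.z-corner S))
              (subst (λ r → F t <[ r ] V z′) (sym r≡r′) (apex-angle (t′≢t ∘ sym) chordal S′ e z′-r′))
              (vertex<face r (Spans.z-corner S′)))
    where
    u∈ij  = reversed-chord-angle t′≢t chordal S e′ O<ij u-q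
    u′∈ij = reversed-chord-angle (t′≢t ∘ sym) chordal S′ e O<ij u′-q
    r≡r′ : r ≡ r′
    r≡r′ = third-unique
      (angle-colours-distinct u-q (k , ex , ck) u≢x)
      (angle-colours-distinct z-r u-q (apex-not-endpoint S u∈ij))
      (angle-colours-distinct z-r (k , ex , ck) (apex-not-endpoint S x∈ij))
      (angle-colours-distinct z′-r′ u′-q (apex-not-endpoint S′ u′∈ij))
      (angle-colours-distinct z′-r′ (k′ , ex′ , ck′) (apex-not-endpoint S′ x∈ij))

  colour-above-outer : ∀ {t c} → HasColor M C t c → O <[ c ] F t
  colour-above-outer {t} (i , j , e , chordal , t′ , t′≢t , e′ , coloured)
    with realizer-reverses (E i j) O (t , e) tt chordal (λ ())
  ... | q , O<ij with reversed-chord-colour t′≢t chordal e e′ coloured O<ij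
  ...   | refl = <-trans O<ij (edge<face q e)

  no-two-common-colours : ∀ {s t c₁ c₂} → s ≢ t → c₁ ≢ c₂ → HasColor M C s c₁ → HasColor M C s c₂
                        → HasColor M C t c₁ → HasColor M C t c₂ → ⊥
  no-two-common-colours {s} {t} s≢t c₁≢c₂ s-c₁ s-c₂ t-c₁ t-c₂
    with private-corner (s≢t ∘ sym) | private-corner s≢t
  ... | kv , v∉s | kw , w∉t
    with realizer-reverses (V (corner (tri t) kv)) (F s) tt tt v∉s (λ ())
       | realizer-reverses (V (corner (tri s) kw)) (F t) tt tt w∉t (λ ())
  ... | q , s<v | q′ , t<w =
    no-4-cycle s<v (vertex<face q (kv , refl)) (subst (λ q → F t <[ q ] V _) (sym q≡q′) t<w) (vertex<face q (kw , refl))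
    where
    not-colour : ∀ {s q c x} → HasColor M C s c → F s <[ q ] V x → q ≢ c
    not-colour {x = x} s-c s<x refl = <-asym (colour-above-outer s-c) (<-trans s<x (vertex<outer _ x))
    q≡q′ : q ≡ q′
    q≡q′ = third-unique c₁≢c₂ (not-colour s-c₁ s<v) (not-colour s-c₂ s<v) (not-colour t-c₁ t<w) (not-colour t-c₂ t<w)

proposition3p11 : ∀ {n} (M : MaxPathLike n) (R : Realizer M) (C : AngleColoring M R)
                  → ∀ (s t : Fin (n ∸ 2)) → s ≢ t
                  → Bicolored M C s → Bicolored M C t
                  → ¬ (∀ c → (HasColor M C s c → HasColor M C t c)
                             × (HasColor M C t c → HasColor M C s c))
proposition3p11 M R C s t s≢t (c₁ , c₂ , c₁≢c₂ , s-c₁ , s-c₂ , _) _ same-colours =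
  Colouring.no-two-common-colours M R C s≢t c₁≢c₂ s-c₁ s-c₂
    (proj₁ (same-colours c₁) s-c₁) (proj₁ (same-colours c₂) s-c₂)
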